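{- Let $\mathbf{f}_1,\dots,\mathbf{f}_n\in\mathbb{Z}[t]^m$ (not necessarily $\mathbb{Z}$-linearly independent) have degrees $d_1\le\dots\le d_n$. Then there exist $\mathbf{g}_1,\dots,\mathbf{g}_n\in\mathbb{Z}[t]^m$ of degrees $d_1'\le\dots\le d_n'$ such that: (1) $\operatorname{Span}_{\mathbb{Z}}\{\mathbf{g}_1,\dots,\mathbf{g}_n\}=\operatorname{Span}_{\mathbb{Z}}\{\mathbf{f}_1,\dots,\mathbf{f}_n\}$; (2) $d_i'\le d_i$ for $1\le i\le n$; (3) for each degree $d$, the set of pilot vectors of those $\mathbf{g}_i$ of degree $d$ is linearly independent over $\mathbb{Q}$; (4) $d_i'=d_i$ for every $i$ if and only if for every $d$ the set of pilot vectors of $\{\mathbf{f}_i:\deg(\mathbf{f}_i)=d\}$ is linearly independent.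
   Context: For $\mathbf{f}\in\mathbb{Z}[t]^m$, $\deg\mathbf{f}$ is the maximum degree of its coordinates, with the convention $\deg(\mathbf{0})=-\infty$; the pilot vector $\widetilde{\mathbf{f}}\in\mathbb{Z}^m$ of a nonzero $\mathbf{f}$ is the vector of coefficients of $t^{\deg\mathbf{f}}$. -}

module Defs where

open import Data.Nat using (ℕ; zero; suc)
import Data.Nat as ℕ
open import Data.Integer as ℤ using (ℤ)
open import Data.Integer.Properties using () renaming (_≟_ to _≟ℤ_)
open import Data.Rational as ℚ using (ℚ)
open import Data.Fin as Fin using (Fin)
open import Data.List using (List; []; _∷_)
open import Data.Maybe using (Maybe; just; nothing)
open import Data.Product using (∃; _×_)
open import Relation.Nullary using (yes; no; ¬_)
open import Relation.Binary.PropositionalEquality using (_≡_)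
open import Function.Bundles using (_⇔_)

-- A polynomial in ℤ[t]: list of coefficients, constant term first
-- (trailing zeros allowed; all notions below depend only on coefficients).
Poly : Set
Poly = List ℤ

coeff : Poly → ℕ → ℤ
coeff []       _       = ℤ.0ℤ
coeff (a ∷ p)  zero    = a
coeff (a ∷ p)  (suc k) = coeff p k

-- Degrees: nothing = -∞ (degree of the zero polynomial), just d = d.
Deg : Set
Deg = Maybe ℕ

maxDeg : Deg → Deg → Deg
maxDeg nothing  e        = e
maxDeg (just d) nothing  = just d
maxDeg (just d) (just e) = just (d ℕ.⊔ e)

polyDeg : Poly → Deg
polyDeg []      = nothing
polyDeg (a ∷ p) with polyDeg p
... | just d  = just (suc d)
... | nothing with a ≟ℤ ℤ.0ℤ
...   | yes _ = nothing
...   | no  _ = just 0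

data _≤D_ : Deg → Deg → Set where
  -∞≤   : ∀ {e} → nothing ≤D e
  fin≤  : ∀ {d e} → d ℕ.≤ e → just d ≤D just e

PolyVec : ℕ → Set
PolyVec m = Fin m → Poly

deg : ∀ {m} → PolyVec m → Deg
deg {zero}  f = nothing
deg {suc m} f = maxDeg (polyDeg (f Fin.zero)) (deg (λ i → f (Fin.suc i)))

-- pilot vector: coefficients of t^d, used when deg f ≡ just d
pilot : ∀ {m} → PolyVec m → ℕ → Fin m → ℤ
pilot f d j = coeff (f j) d

sumℤ : ∀ {n} → (Fin n → ℤ) → ℤ
sumℤ {zero}  c = ℤ.0ℤ
sumℤ {suc n} c = c Fin.zero ℤ.+ sumℤ (λ i → c (Fin.suc i))

sumℚ : ∀ {n} → (Fin n → ℚ) → ℚ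
sumℚ {zero}  c = ℚ.0ℚ
sumℚ {suc n} c = c Fin.zero ℚ.+ sumℚ (λ i → c (Fin.suc i))

toℚ : ℤ → ℚ
toℚ z = z ℚ./ 1

InSpan : ∀ {m n} → PolyVec m → (Fin n → PolyVec m) → Set
InSpan {m} {n} v f = ∃ λ (c : Fin n → ℤ) →
  ∀ (j : Fin m) (k : ℕ) → coeff (v j) k ≡ sumℤ (λ i → c i ℤ.* coeff (f i j) k)

SameSpan : ∀ {m n} → (Fin n → PolyVec m) → (Fin n → PolyVec m) → Set
SameSpan {m} g f = ∀ (v : PolyVec m) → (InSpan v g ⇔ InSpan v f)

DegSorted : ∀ {m n} → (Fin n → PolyVec m) → Set
DegSorted {n = n} f = ∀ (i j : Fin n) → i Fin.≤ j → deg (f i) ≤D deg (f j)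

PilotIndep : ∀ {m n} → (Fin n → PolyVec m) → ℕ → Set
PilotIndep {m} {n} f d = ∀ (c : Fin n → ℚ) →
  (∀ i → ¬ (deg (f i) ≡ just d) → c i ≡ ℚ.0ℚ) →
  (∀ (j : Fin m) → sumℚ (λ i → c i ℚ.* toℚ (pilot (f i) d j)) ≡ ℚ.0ℚ) →
  ∀ i → c i ≡ ℚ.0ℚ

-- A nontrivial ℚ-relation among the pilot vectors of the degree-d members of a
-- family can be taken integral, Σ cᵢ g̃ᵢ = 0.  Run Euclid's algorithm on two
-- nonzero coefficients |c_a| ≤ |c_b|: replacing g_a by g_a + q g_b with
-- q = c_b div c_a keeps the ℤ-span and deg g_a ≤ d, and if deg g_a stays d the
-- relation survives with c_b replaced by c_b mod c_a.  So eventually some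
-- degree drops, which decreases Σᵢ rank(deg gᵢ); repeating until every degree
-- class has independent pilot vectors (decided by fraction-free Gaussian
-- elimination) terminates.  A bubble sort by degree then restores the order,
-- and keeps d′ᵢ ≤ dᵢ because the dᵢ are sorted.  For (4): an independent f is
-- its own answer, while a dependent f loses rank in the first lowering step,
-- so its degrees cannot all survive.

module Submission where

open import Defs
open import Algebra.Bundles using (CommutativeSemiring; CommutativeRing)
open import Data.Empty using (⊥-elim)
open import Data.Fin as Fin using (Fin)
import Data.Fin.Properties as Fin
open import Data.Fin.Permutation as Perm using (Permutation′; _⟨$⟩ʳ_; _⟨$⟩ˡ_)
open import Data.Integer as ℤ using (ℤ)
import Data.Integer.DivMod as ℤD
import Data.Integer.Properties as ℤ
open import Data.Integer.Tactic.RingSolver using (solve-∀)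
open import Data.List as List using ([]; _∷_)
open import Data.Maybe using (just; nothing)
import Data.Maybe.Properties as Maybe
open import Data.Nat as ℕ using (ℕ; zero; suc)
import Data.Nat.Induction as ℕ
import Data.Nat.Properties as ℕ
open import Data.Nat.Tactic.RingSolver using () renaming (solve-∀ to ℕ-solve-∀)
open import Algebra.Properties.Semiring.Sum ℕ.+-*-semiring using () renaming (sum to sumℕ)
open import Data.Product using (Σ; Σ-syntax; ∃; ∃₂; _×_; _,_; proj₁; proj₂)
open import Data.Rational as ℚ using (ℚ)
open import Data.Rational.Literals using (fromℤ)
import Data.Rational.Properties as ℚ
open import Data.Sum as Sum using (_⊎_; inj₁; inj₂)
open import Data.Vec.Functional using (Vector; updateAt; removeAt)
open import Data.Vec.Functional.Properties using (updateAt-updates; updateAt-minimal)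
open import Function using (_∘_; const)
open import Function.Bundles using (_⇔_; mk⇔)
open import Function.Properties.Equivalence using (⇔-isEquivalence)
open import Induction.WellFounded using (Acc; acc)
open import Level using (0ℓ)
open import Relation.Binary.PropositionalEquality as ≡ using (_≡_; _≢_; refl; sym; trans; cong; cong₂)
open import Relation.Binary.Structures using (IsEquivalence)
open import Relation.Nullary using (¬_; Dec; yes; no)
open import Relation.Nullary.Decidable using (¬?; _×-dec_; map′; decidable-stable; dec-true; dec-false)
open import Relation.Unary using (Decidable)

module FiniteSum {c ℓ} (R : CommutativeSemiring c ℓ) where
  open CommutativeSemiring R hiding (zero; refl; sym; trans; reflexive)
  open CommutativeSemiring R using () renaming (sym to ≈-sym; trans to ≈-trans; reflexive to ≈-reflexive)
  open import Algebra.Properties.Semiring.Sum semiring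
  open import Algebra.Properties.CommutativeSemigroup +-commutativeSemigroup using (xy∙z≈xz∙y)
  open import Algebra.Properties.CommutativeSemigroup *-commutativeSemigroup using (x∙yz≈y∙xz)
  open import Relation.Binary.Reasoning.Setoid setoid

  -- Lets the recursively defined sumℤ and sumℚ of Defs use the library's lemmas about sum.
  module Properties (Σ : ∀ {n} → Vector Carrier n → Carrier)
                    (Σ-zero : (f : Vector Carrier 0) → Σ f ≡ 0#)
                    (Σ-suc : ∀ {n} (f : Vector Carrier (suc n)) → Σ f ≡ f Fin.zero + Σ (f ∘ Fin.suc)) where

    Σ≈sum : ∀ {n} (f : Vector Carrier n) → Σ f ≈ sum f
    Σ≈sum {zero} f = ≈-reflexive (Σ-zero f)
    Σ≈sum {suc n} f = ≈-trans (≈-reflexive (Σ-suc f)) (+-congˡ (Σ≈sum (f ∘ Fin.suc)))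

    Σ-cong : ∀ {n} {f g : Vector Carrier n} → (∀ i → f i ≈ g i) → Σ f ≈ Σ g
    Σ-cong {f = f} {g} f≈g = begin
      Σ f   ≈⟨ Σ≈sum f ⟩
      sum f ≈⟨ sum-cong-≋ f≈g ⟩
      sum g ≈⟨ Σ≈sum g ⟨
      Σ g   ∎

    Σ-zeros : ∀ {n} {f : Vector Carrier n} → (∀ i → f i ≈ 0#) → Σ f ≈ 0#
    Σ-zeros {n} f≈0 = ≈-trans (Σ-cong f≈0) (≈-trans (Σ≈sum _) (sum-replicate-zero n))

    Σ-single : ∀ {n} {f : Vector Carrier n} p → (∀ i → i ≢ p → f i ≈ 0#) → Σ f ≈ f p
    Σ-single {suc n} {f} p f≈0 = begin
      Σ f                          ≈⟨ Σ≈sum f ⟩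
      sum f                        ≈⟨ sum-remove f ⟩
      f p + sum (removeAt f p)     ≈⟨ +-congˡ (sum-cong-≋ (λ k → f≈0 _ (Fin.punchInᵢ≢i p k))) ⟩
      f p + sum {n} (λ _ → 0#)     ≈⟨ +-congˡ (sum-replicate-zero n) ⟩
      f p + 0#                     ≈⟨ +-identityʳ (f p) ⟩
      f p                          ∎

    Σ-permute : ∀ {n} (f : Vector Carrier n) (π : Permutation′ n) → Σ (f ∘ (π ⟨$⟩ʳ_)) ≈ Σ f
    Σ-permute f π = begin
      Σ (f ∘ (π ⟨$⟩ʳ_))   ≈⟨ Σ≈sum _ ⟩
      sum (f ∘ (π ⟨$⟩ʳ_)) ≈⟨ sum-permute f π ⟨
      sum f               ≈⟨ Σ≈sum f ⟨
      Σ f                 ∎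

    Σ-+ : ∀ {n} (f g : Vector Carrier n) → Σ (λ i → f i + g i) ≈ Σ f + Σ g
    Σ-+ f g = ≈-trans (Σ≈sum _) (≈-trans (∑-distrib-+ f g) (≈-sym (+-cong (Σ≈sum f) (Σ≈sum g))))

    Σ-*ˡ : ∀ {n} a (f : Vector Carrier n) → Σ (λ i → a * f i) ≈ a * Σ f
    Σ-*ˡ a f = ≈-trans (Σ≈sum _) (≈-trans (≈-sym (*-distribˡ-sum a f)) (*-congˡ (≈-sym (Σ≈sum f))))

    Σ-*ʳ : ∀ {n} a (f : Vector Carrier n) → Σ (λ i → f i * a) ≈ Σ f * a
    Σ-*ʳ a f = ≈-trans (Σ≈sum _) (≈-trans (≈-sym (*-distribʳ-sum a f)) (*-congʳ (≈-sym (Σ≈sum f))))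

    Σ-addAt : ∀ {n} (f : Vector Carrier n) p t → Σ (updateAt f p (_+ t)) ≈ Σ f + t
    Σ-addAt {suc n} f Fin.zero t = begin
      Σ (updateAt f Fin.zero (_+ t))   ≡⟨ Σ-suc _ ⟩
      (f Fin.zero + t) + Σ (f ∘ Fin.suc) ≈⟨ xy∙z≈xz∙y _ _ _ ⟩
      (f Fin.zero + Σ (f ∘ Fin.suc)) + t ≡⟨ ≡.cong (_+ t) (Σ-suc f) ⟨
      Σ f + t                        ∎
    Σ-addAt {suc n} f (Fin.suc p) t = begin
      Σ (updateAt f (Fin.suc p) (_+ t))                       ≡⟨ Σ-suc _ ⟩
      f Fin.zero + Σ (updateAt (f ∘ Fin.suc) p (_+ t))        ≈⟨ +-congˡ (Σ-addAt (f ∘ Fin.suc) p t) ⟩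
      f Fin.zero + (Σ (f ∘ Fin.suc) + t)                      ≈⟨ +-assoc _ _ _ ⟨
      (f Fin.zero + Σ (f ∘ Fin.suc)) + t                      ≡⟨ ≡.cong (_+ t) (Σ-suc f) ⟨
      Σ f + t                                                 ∎

    Σ-addAtˡ : ∀ {n} (c x : Vector Carrier n) p t →
               Σ (λ i → updateAt c p (_+ t) i * x i) ≈ Σ (λ i → c i * x i) + t * x p
    Σ-addAtˡ c x p t = ≈-trans (Σ-cong pointwise) (Σ-addAt _ p _)
      where
      pointwise : ∀ i → updateAt c p (_+ t) i * x i ≈ updateAt (λ i → c i * x i) p (_+ t * x p) i
      pointwise i with i Fin.≟ p
      ... | yes ≡.refl = begin
        updateAt c i (_+ t) i * x i             ≡⟨ ≡.cong (_* x i) (updateAt-updates i c) ⟩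
        (c i + t) * x i                         ≈⟨ distribʳ (x i) (c i) t ⟩
        c i * x i + t * x i                     ≡⟨ updateAt-updates i (λ i → c i * x i) ⟨
        updateAt (λ i → c i * x i) i (_+ t * x i) i ∎
      ... | no i≢p = ≈-reflexive (≡.trans (≡.cong (_* x i) (updateAt-minimal i p c i≢p))
                                        (≡.sym (updateAt-minimal i p (λ i → c i * x i) i≢p)))

    Σ-addAtʳ : ∀ {n} (c x : Vector Carrier n) p t →
               Σ (λ i → c i * updateAt x p (_+ t) i) ≈ Σ (λ i → c i * x i) + c p * t
    Σ-addAtʳ c x p t = ≈-trans (Σ-cong pointwise) (Σ-addAt _ p _)
      where
      pointwise : ∀ i → c i * updateAt x p (_+ t) i ≈ updateAt (λ i → c i * x i) p (_+ c p * t) i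
      pointwise i with i Fin.≟ p
      ... | yes ≡.refl = begin
        c i * updateAt x i (_+ t) i             ≡⟨ ≡.cong (c i *_) (updateAt-updates i x) ⟩
        c i * (x i + t)                         ≈⟨ distribˡ (c i) (x i) t ⟩
        c i * x i + c i * t                     ≡⟨ updateAt-updates i (λ i → c i * x i) ⟨
        updateAt (λ i → c i * x i) i (_+ c i * t) i ∎
      ... | no i≢p = ≈-reflexive (≡.trans (≡.cong (c i *_) (updateAt-minimal i p x i≢p))
                                        (≡.sym (updateAt-minimal i p (λ i → c i * x i) i≢p)))

    Σ-eliminate : ∀ {n} (c x b : Vector Carrier n) a y →
                  Σ (λ i → c i * (a * x i + b i * y)) ≈ a * Σ (λ i → c i * x i) + Σ (λ i → c i * b i) * y
    Σ-eliminate c x b a y = begin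
      Σ (λ i → c i * (a * x i + b i * y))                         ≈⟨ Σ-cong pointwise ⟩
      Σ (λ i → a * (c i * x i) + (c i * b i) * y)                 ≈⟨ Σ-+ _ _ ⟩
      Σ (λ i → a * (c i * x i)) + Σ (λ i → (c i * b i) * y)       ≈⟨ +-cong (Σ-*ˡ a _) (Σ-*ʳ y _) ⟩
      a * Σ (λ i → c i * x i) + Σ (λ i → c i * b i) * y           ∎
      where
      pointwise : ∀ i → c i * (a * x i + b i * y) ≈ a * (c i * x i) + (c i * b i) * y
      pointwise i = ≈-trans (distribˡ (c i) _ _) (+-cong (x∙yz≈y∙xz (c i) a (x i)) (≈-sym (*-assoc (c i) (b i) y)))

    Σ-two : ∀ {n} (f g : Vector Carrier n) a b → a ≢ b → (∀ i → i ≢ a → i ≢ b → f i ≈ g i) →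
            Σ f + (g a + g b) ≈ Σ g + (f a + f b)
    Σ-two f g a b a≢b f≈g = begin
      Σ f + (g a + g b)   ≈⟨ +-assoc _ _ _ ⟨
      Σ f + g a + g b     ≈⟨ +-congʳ (Σ-addAt f a (g a)) ⟨
      Σ fa + g b          ≈⟨ Σ-addAt fa b (g b) ⟨
      Σ (updateAt fa b (_+ g b)) ≈⟨ Σ-cong swapped ⟩
      Σ (updateAt ga b (_+ f b)) ≈⟨ Σ-addAt ga b (f b) ⟩
      Σ ga + f b          ≈⟨ +-congʳ (Σ-addAt g a (f a)) ⟩
      Σ g + f a + f b     ≈⟨ +-assoc _ _ _ ⟩
      Σ g + (f a + f b)   ∎
      where
      fa = updateAt f a (_+ g a)
      ga = updateAt g a (_+ f a)
      swapped : ∀ i → updateAt fa b (_+ g b) i ≈ updateAt ga b (_+ f b) i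
      swapped i with i Fin.≟ b | i Fin.≟ a
      ... | yes ≡.refl | _ = begin
        updateAt fa i (_+ g i) i ≡⟨ updateAt-updates i fa ⟩
        fa i + g i               ≡⟨ ≡.cong (_+ g i) (updateAt-minimal i a f (a≢b ∘ ≡.sym)) ⟩
        f i + g i                ≈⟨ +-comm (f i) (g i) ⟩
        g i + f i                ≡⟨ ≡.cong (_+ f i) (updateAt-minimal i a g (a≢b ∘ ≡.sym)) ⟨
        ga i + f i               ≡⟨ updateAt-updates i ga ⟨
        updateAt ga i (_+ f i) i ∎
      ... | no i≢b | yes ≡.refl = begin
        updateAt fa b (_+ g b) i ≡⟨ updateAt-minimal i b fa i≢b ⟩
        fa i                     ≡⟨ updateAt-updates i f ⟩
        f i + g i                ≈⟨ +-comm (f i) (g i) ⟩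
        g i + f i                ≡⟨ updateAt-updates i g ⟨
        ga i                     ≡⟨ updateAt-minimal i b ga i≢b ⟨
        updateAt ga b (_+ f b) i ∎
      ... | no i≢b | no i≢a = begin
        updateAt fa b (_+ g b) i ≡⟨ updateAt-minimal i b fa i≢b ⟩
        fa i                     ≡⟨ updateAt-minimal i a f i≢a ⟩
        f i                      ≈⟨ f≈g i i≢a i≢b ⟩
        g i                      ≡⟨ updateAt-minimal i a g i≢a ⟨
        ga i                     ≡⟨ updateAt-minimal i b ga i≢b ⟨
        updateAt ga b (_+ f b) i ∎

module Σℤ = FiniteSum.Properties ℤ.+-*-commutativeSemiring sumℤ (λ _ → refl) (λ _ → refl)

module Σℚ = FiniteSum.Properties (CommutativeRing.commutativeSemiring ℚ.+-*-commutativeRing) sumℚ (λ _ → refl) (λ _ → refl)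

module Σℕ = FiniteSum.Properties ℕ.+-*-commutativeSemiring sumℕ (λ _ → refl) (λ _ → refl)

sumℕ-mono-≤ : ∀ {n} {f g : Fin n → ℕ} → (∀ i → f i ℕ.≤ g i) → sumℕ f ℕ.≤ sumℕ g
sumℕ-mono-≤ {zero}  f≤g = ℕ.z≤n
sumℕ-mono-≤ {suc n} f≤g = ℕ.+-mono-≤ (f≤g Fin.zero) (sumℕ-mono-≤ (f≤g ∘ Fin.suc))

sumℕ-mono-< : ∀ {n} {f g : Fin n → ℕ} p → (∀ i → f i ℕ.≤ g i) → f p ℕ.< g p → sumℕ f ℕ.< sumℕ g
sumℕ-mono-< Fin.zero    f≤g fp<gp = ℕ.+-mono-<-≤ fp<gp (sumℕ-mono-≤ (f≤g ∘ Fin.suc))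
sumℕ-mono-< (Fin.suc p) f≤g fp<gp = ℕ.+-mono-≤-< (f≤g Fin.zero) (sumℕ-mono-< p (f≤g ∘ Fin.suc) fp<gp)

Σℤ-transvection : ∀ {n} (c x : Fin n → ℤ) {a b} q → a ≢ b →
  sumℤ (λ i → updateAt c b (ℤ._+ ℤ.- (c a ℤ.* q)) i ℤ.* updateAt x a (ℤ._+ q ℤ.* x b) i) ≡ sumℤ (λ i → c i ℤ.* x i)
Σℤ-transvection c x {a} {b} q a≢b = begin
  sumℤ (λ i → c′ i ℤ.* updateAt x a (ℤ._+ q ℤ.* x b) i)           ≡⟨ Σℤ.Σ-addAtʳ c′ x a (q ℤ.* x b) ⟩
  sumℤ (λ i → c′ i ℤ.* x i) ℤ.+ c′ a ℤ.* (q ℤ.* x b)               ≡⟨ cong₂ ℤ._+_ (Σℤ.Σ-addAtˡ c x b _) (cong (ℤ._* (q ℤ.* x b)) c′a≡ca) ⟩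
  (sumℤ (λ i → c i ℤ.* x i) ℤ.+ ℤ.- (c a ℤ.* q) ℤ.* x b) ℤ.+ c a ℤ.* (q ℤ.* x b) ≡⟨ cancel _ (c a) q (x b) ⟩
  sumℤ (λ i → c i ℤ.* x i)                                          ∎
  where
  open ≡.≡-Reasoning
  c′ = updateAt c b (ℤ._+ ℤ.- (c a ℤ.* q))
  c′a≡ca : c′ a ≡ c a
  c′a≡ca = updateAt-minimal a b c a≢b
  cancel : ∀ s y q z → (s ℤ.+ ℤ.- (y ℤ.* q) ℤ.* z) ℤ.+ y ℤ.* (q ℤ.* z) ≡ s
  cancel = solve-∀

toℚ≡fromℤ : ∀ z → toℚ z ≡ fromℤ z
toℚ≡fromℤ z = ℚ.↥p/↧p≡p (fromℤ z)

toℚ-+ : ∀ x y → toℚ (x ℤ.+ y) ≡ toℚ x ℚ.+ toℚ y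
toℚ-+ x y rewrite toℚ≡fromℤ x | toℚ≡fromℤ y =
  ℚ./-cong (sym (cong₂ ℤ._+_ (ℤ.*-identityʳ x) (ℤ.*-identityʳ y))) refl

toℚ-* : ∀ x y → toℚ (x ℤ.* y) ≡ toℚ x ℚ.* toℚ y
toℚ-* x y rewrite toℚ≡fromℤ x | toℚ≡fromℤ y = refl

toℚ-neg : ∀ x → toℚ (ℤ.- x) ≡ ℚ.- toℚ x
toℚ-neg x rewrite toℚ≡fromℤ (ℤ.- x) | toℚ≡fromℤ x with x
... | ℤ.+ 0 = refl
... | ℤ.+[1+ n ] = refl
... | ℤ.-[1+ n ] = refl

toℚ≡0⇒≡0 : ∀ z → toℚ z ≡ ℚ.0ℚ → z ≡ ℤ.0ℤ
toℚ≡0⇒≡0 z eq = ℚ.p≡0⇒↥p≡0 (fromℤ z) (trans (sym (toℚ≡fromℤ z)) eq)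

toℚ-sum : ∀ {n} (f : Fin n → ℤ) → toℚ (sumℤ f) ≡ sumℚ (toℚ ∘ f)
toℚ-sum {zero} f = refl
toℚ-sum {suc n} f = trans (toℚ-+ (f Fin.zero) _) (cong (toℚ (f Fin.zero) ℚ.+_) (toℚ-sum (f ∘ Fin.suc)))

p*q≡0⇒p≡0 : ∀ p q → q ≢ ℚ.0ℚ → p ℚ.* q ≡ ℚ.0ℚ → p ≡ ℚ.0ℚ
p*q≡0⇒p≡0 p q q≢0 pq≡0 = begin
  p                    ≡⟨ ℚ.*-identityʳ p ⟨
  p ℚ.* ℚ.1ℚ           ≡⟨ cong (p ℚ.*_) (ℚ.*-inverseʳ q) ⟨
  p ℚ.* (q ℚ.* ℚ.1/ q) ≡⟨ ℚ.*-assoc p q _ ⟨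
  (p ℚ.* q) ℚ.* ℚ.1/ q ≡⟨ cong (ℚ._* ℚ.1/ q) pq≡0 ⟩
  ℚ.0ℚ ℚ.* ℚ.1/ q      ≡⟨ ℚ.*-zeroˡ (ℚ.1/ q) ⟩
  ℚ.0ℚ                 ∎
  where
  open ≡.≡-Reasoning
  instance _ = ℚ.≢-nonZero q≢0

-- Linear independence over ℚ of integer vectors

-- Only the vectors vᵢ with P i take part; PilotIndep g d is the case
-- P i = (deg (g i) ≡ just d), vᵢ = pilot (g i) d.
Independent : ∀ {n m} → (Fin n → Set) → (Fin n → Fin m → ℤ) → Set
Independent {n} {m} P v = ∀ (c : Fin n → ℚ) → (∀ i → ¬ P i → c i ≡ ℚ.0ℚ) →
  (∀ j → sumℚ (λ i → c i ℚ.* toℚ (v i j)) ≡ ℚ.0ℚ) → ∀ i → c i ≡ ℚ.0ℚ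

record Relation {n m} (P : Fin n → Set) (v : Fin n → Fin m → ℤ) : Set where
  field
    coef      : Fin n → ℤ
    supported : ∀ i → ¬ P i → coef i ≡ ℤ.0ℤ
    witness   : Fin n
    witness≢0 : coef witness ≢ ℤ.0ℤ
    vanishes  : ∀ j → sumℤ (λ i → coef i ℤ.* v i j) ≡ ℤ.0ℤ

relation⇒¬independent : ∀ {n m} {P : Fin n → Set} {v : Fin n → Fin m → ℤ} →
                        Relation P v → ¬ Independent P v
relation⇒¬independent {v = v} r indep =
  witness≢0 (toℚ≡0⇒≡0 _ (indep (toℚ ∘ coef) (λ i ¬Pi → cong toℚ (supported i ¬Pi)) vanishesℚ witness))
  where
  open Relation r
  vanishesℚ : ∀ j → sumℚ (λ i → toℚ (coef i) ℚ.* toℚ (v i j)) ≡ ℚ.0ℚ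
  vanishesℚ j = begin
    sumℚ (λ i → toℚ (coef i) ℚ.* toℚ (v i j)) ≡⟨ Σℚ.Σ-cong (λ i → toℚ-* (coef i) (v i j)) ⟨
    sumℚ (λ i → toℚ (coef i ℤ.* v i j))       ≡⟨ toℚ-sum (λ i → coef i ℤ.* v i j) ⟨
    toℚ (sumℤ (λ i → coef i ℤ.* v i j))       ≡⟨ cong toℚ (vanishes j) ⟩
    ℚ.0ℚ                                      ∎
    where open ≡.≡-Reasoning

module Pivot {n m} (P : Fin n → Set) (v : Fin n → Fin (suc m) → ℤ) (p : Fin n) (Pp : P p)
             (a≢0 : v p Fin.zero ≢ ℤ.0ℤ) where

  a : ℤ
  a = v p Fin.zero

  P′ : Fin n → Set
  P′ i = P i × i ≢ p

  -- Fraction-free elimination of the first coordinate against the pivot vector v p.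
  v′ : Fin n → Fin m → ℤ
  v′ i j = a ℤ.* v i (Fin.suc j) ℤ.+ v i Fin.zero ℤ.* ℤ.- v p (Fin.suc j)

  v′-pivot : ∀ j → v′ p j ≡ ℤ.0ℤ
  v′-pivot j = lemma a (v p (Fin.suc j))
    where
    lemma : ∀ a y → a ℤ.* y ℤ.+ a ℤ.* ℤ.- y ≡ ℤ.0ℤ
    lemma = solve-∀

  toℚ-v′ : ∀ i j → toℚ (v′ i j) ≡ toℚ a ℚ.* toℚ (v i (Fin.suc j)) ℚ.+ toℚ (v i Fin.zero) ℚ.* ℚ.- toℚ (v p (Fin.suc j))
  toℚ-v′ i j = begin
    toℚ (v′ i j) ≡⟨ toℚ-+ (a ℤ.* v i (Fin.suc j)) (v i Fin.zero ℤ.* ℤ.- v p (Fin.suc j)) ⟩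
    toℚ (a ℤ.* v i (Fin.suc j)) ℚ.+ toℚ (v i Fin.zero ℤ.* ℤ.- v p (Fin.suc j))
      ≡⟨ cong₂ ℚ._+_ (toℚ-* a (v i (Fin.suc j)))
               (trans (toℚ-* (v i Fin.zero) (ℤ.- v p (Fin.suc j))) (cong (toℚ (v i Fin.zero) ℚ.*_) (toℚ-neg (v p (Fin.suc j))))) ⟩
    toℚ a ℚ.* toℚ (v i (Fin.suc j)) ℚ.+ toℚ (v i Fin.zero) ℚ.* ℚ.- toℚ (v p (Fin.suc j)) ∎
    where open ≡.≡-Reasoning

  independent : Independent P′ v′ → Independent P v
  independent indep′ c c-supported c-vanishes = c≡0
    where
    open ≡.≡-Reasoning
    A = toℚ a
    X : Fin m → Fin n → ℚ
    X j i = toℚ (v i (Fin.suc j))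
    B : Fin n → ℚ
    B i = toℚ (v i Fin.zero)

    c′ : Fin n → ℚ
    c′ = updateAt c p (const ℚ.0ℚ)

    c′-supported : ∀ i → ¬ P′ i → c′ i ≡ ℚ.0ℚ
    c′-supported i ¬P′i with i Fin.≟ p
    ... | yes refl = updateAt-updates p c
    ... | no i≢p = trans (updateAt-minimal i p c i≢p) (c-supported i (λ Pi → ¬P′i (Pi , i≢p)))

    c′v′≡cv′ : ∀ j i → c′ i ℚ.* toℚ (v′ i j) ≡ c i ℚ.* toℚ (v′ i j)
    c′v′≡cv′ j i with i Fin.≟ p
    ... | yes refl rewrite v′-pivot j = trans (ℚ.*-zeroʳ (c′ p)) (sym (ℚ.*-zeroʳ (c p)))
    ... | no i≢p = cong (ℚ._* _) (updateAt-minimal i p c i≢p)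

    c′-vanishes : ∀ j → sumℚ (λ i → c′ i ℚ.* toℚ (v′ i j)) ≡ ℚ.0ℚ
    c′-vanishes j = begin
      sumℚ (λ i → c′ i ℚ.* toℚ (v′ i j))                         ≡⟨ Σℚ.Σ-cong (c′v′≡cv′ j) ⟩
      sumℚ (λ i → c i ℚ.* toℚ (v′ i j))                          ≡⟨ Σℚ.Σ-cong (λ i → cong (c i ℚ.*_) (toℚ-v′ i j)) ⟩
      sumℚ (λ i → c i ℚ.* (A ℚ.* X j i ℚ.+ B i ℚ.* ℚ.- Y))       ≡⟨ Σℚ.Σ-eliminate c (X j) B A (ℚ.- Y) ⟩
      A ℚ.* sumℚ (λ i → c i ℚ.* X j i) ℚ.+ sumℚ (λ i → c i ℚ.* B i) ℚ.* ℚ.- Y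
        ≡⟨ cong₂ (λ s t → A ℚ.* s ℚ.+ t ℚ.* ℚ.- Y) (c-vanishes (Fin.suc j)) (c-vanishes Fin.zero) ⟩
      A ℚ.* ℚ.0ℚ ℚ.+ ℚ.0ℚ ℚ.* ℚ.- Y                              ≡⟨ cong₂ ℚ._+_ (ℚ.*-zeroʳ A) (ℚ.*-zeroˡ (ℚ.- Y)) ⟩
      ℚ.0ℚ                                                       ∎
      where Y = toℚ (v p (Fin.suc j))

    off-pivot : ∀ i → i ≢ p → c i ≡ ℚ.0ℚ
    off-pivot i i≢p = trans (sym (updateAt-minimal i p c i≢p)) (indep′ c′ c′-supported c′-vanishes i)

    at-pivot : c p ≡ ℚ.0ℚ
    at-pivot = p*q≡0⇒p≡0 (c p) A (a≢0 ∘ toℚ≡0⇒≡0 a) (begin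
      c p ℚ.* A                     ≡⟨ Σℚ.Σ-single p (λ i i≢p → trans (cong (ℚ._* B i) (off-pivot i i≢p)) (ℚ.*-zeroˡ (B i))) ⟨
      sumℚ (λ i → c i ℚ.* B i)      ≡⟨ c-vanishes Fin.zero ⟩
      ℚ.0ℚ                          ∎)

    c≡0 : ∀ i → c i ≡ ℚ.0ℚ
    c≡0 i with i Fin.≟ p
    ... | yes refl = at-pivot
    ... | no i≢p = off-pivot i i≢p

  relation : Relation P′ v′ → Relation P v
  relation r = record
    { coef      = c
    ; supported = c-supported
    ; witness   = witness
    ; witness≢0 = c-witness≢0
    ; vanishes  = c-vanishes
    }
    where
    open Relation r renaming (coef to e; supported to e-supported; vanishes to e-vanishes)
    open ≡.≡-Reasoning

    T : ℤ
    T = sumℤ (λ i → e i ℤ.* v i Fin.zero)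

    c : Fin n → ℤ
    c = updateAt (λ i → a ℤ.* e i) p (ℤ._+ ℤ.- T)

    e-pivot : e p ≡ ℤ.0ℤ
    e-pivot = e-supported p (λ (_ , p≢p) → p≢p refl)

    c-supported : ∀ i → ¬ P i → c i ≡ ℤ.0ℤ
    c-supported i ¬Pi = begin
      c i         ≡⟨ updateAt-minimal i p _ (λ { refl → ¬Pi Pp }) ⟩
      a ℤ.* e i   ≡⟨ cong (a ℤ.*_) (e-supported i (λ (Pi , _) → ¬Pi Pi)) ⟩
      a ℤ.* ℤ.0ℤ  ≡⟨ ℤ.*-zeroʳ a ⟩
      ℤ.0ℤ        ∎

    c-witness≢0 : c witness ≢ ℤ.0ℤ
    c-witness≢0 cw≡0 with ℤ.i*j≡0⇒i≡0∨j≡0 a (trans (sym (updateAt-minimal witness p _ witness≢p)) cw≡0)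
      where
      witness≢p : witness ≢ p
      witness≢p refl = witness≢0 e-pivot
    ... | inj₁ a≡0 = a≢0 a≡0
    ... | inj₂ ew≡0 = witness≢0 ew≡0

    c·v : ∀ j → sumℤ (λ i → c i ℤ.* v i j) ≡ a ℤ.* sumℤ (λ i → e i ℤ.* v i j) ℤ.+ ℤ.- T ℤ.* v p j
    c·v j = begin
      sumℤ (λ i → c i ℤ.* v i j)                                   ≡⟨ Σℤ.Σ-addAtˡ _ (λ i → v i j) p (ℤ.- T) ⟩
      sumℤ (λ i → (a ℤ.* e i) ℤ.* v i j) ℤ.+ ℤ.- T ℤ.* v p j       ≡⟨ cong (ℤ._+ ℤ.- T ℤ.* v p j) (Σℤ.Σ-cong (λ i → ℤ.*-assoc a (e i) (v i j))) ⟩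
      sumℤ (λ i → a ℤ.* (e i ℤ.* v i j)) ℤ.+ ℤ.- T ℤ.* v p j       ≡⟨ cong (ℤ._+ ℤ.- T ℤ.* v p j) (Σℤ.Σ-*ˡ a (λ i → e i ℤ.* v i j)) ⟩
      a ℤ.* sumℤ (λ i → e i ℤ.* v i j) ℤ.+ ℤ.- T ℤ.* v p j         ∎

    c-vanishes : ∀ j → sumℤ (λ i → c i ℤ.* v i j) ≡ ℤ.0ℤ
    c-vanishes Fin.zero = trans (c·v Fin.zero) (cancel a T)
      where
      cancel : ∀ a T → a ℤ.* T ℤ.+ ℤ.- T ℤ.* a ≡ ℤ.0ℤ
      cancel = solve-∀
    c-vanishes (Fin.suc j) = begin
      sumℤ (λ i → c i ℤ.* v i (Fin.suc j))                                            ≡⟨ c·v (Fin.suc j) ⟩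
      a ℤ.* sumℤ (λ i → e i ℤ.* v i (Fin.suc j)) ℤ.+ ℤ.- T ℤ.* v p (Fin.suc j)         ≡⟨ cong (λ t → a ℤ.* sumℤ (λ i → e i ℤ.* v i (Fin.suc j)) ℤ.+ t) (neg-swap T _) ⟩
      a ℤ.* sumℤ (λ i → e i ℤ.* v i (Fin.suc j)) ℤ.+ T ℤ.* ℤ.- v p (Fin.suc j)         ≡⟨ Σℤ.Σ-eliminate e (λ i → v i (Fin.suc j)) (λ i → v i Fin.zero) a _ ⟨
      sumℤ (λ i → e i ℤ.* v′ i j)                                                      ≡⟨ e-vanishes j ⟩
      ℤ.0ℤ                                                                             ∎
      where
      neg-swap : ∀ x y → ℤ.- x ℤ.* y ≡ x ℤ.* ℤ.- y
      neg-swap = solve-∀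

independent-dropColumn : ∀ {n m} {P : Fin n → Set} {v : Fin n → Fin (suc m) → ℤ} →
                         Independent P (λ i j → v i (Fin.suc j)) → Independent P v
independent-dropColumn indep c c-supported c-vanishes = indep c c-supported (c-vanishes ∘ Fin.suc)

relation-dropColumn : ∀ {n m} {P : Fin n → Set} {v : Fin n → Fin (suc m) → ℤ} →
                      (∀ i → P i → v i Fin.zero ≡ ℤ.0ℤ) →
                      Relation P (λ i j → v i (Fin.suc j)) → Relation P v
relation-dropColumn {P = P} {v} column₀≡0 r = record
  { coef = coef ; supported = supported ; witness = witness ; witness≢0 = witness≢0 ; vanishes = vanishes′ }
  where
  open Relation r
  term₀≡0 : ∀ i → coef i ℤ.* v i Fin.zero ≡ ℤ.0ℤ
  term₀≡0 i with v i Fin.zero ℤ.≟ ℤ.0ℤ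
  ... | yes vi₀≡0 = trans (cong (coef i ℤ.*_) vi₀≡0) (ℤ.*-zeroʳ (coef i))
  ... | no vi₀≢0 = trans (cong (ℤ._* v i Fin.zero) (supported i (vi₀≢0 ∘ column₀≡0 i))) (ℤ.*-zeroˡ (v i Fin.zero))
  vanishes′ : ∀ j → sumℤ (λ i → coef i ℤ.* v i j) ≡ ℤ.0ℤ
  vanishes′ Fin.zero = Σℤ.Σ-zeros term₀≡0
  vanishes′ (Fin.suc j) = vanishes j

independent⊎relation : ∀ {n} m (P : Fin n → Set) → Decidable P → (v : Fin n → Fin m → ℤ) →
                       Independent P v ⊎ Relation P v
independent⊎relation zero P P? v with Fin.any? P?
... | no ¬∃P = inj₁ (λ c c-supported _ i → c-supported i (λ Pi → ¬∃P (i , Pi)))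
... | yes (k , Pk) = inj₂ (record
  { coef      = e
  ; supported = λ i ¬Pi → updateAt-minimal i k _ (λ { refl → ¬Pi Pk })
  ; witness   = k
  ; witness≢0 = λ ek≡0 → 1≢0 (trans (sym (updateAt-updates k (const ℤ.0ℤ))) ek≡0)
  ; vanishes  = λ ()
  })
  where
  e : Fin _ → ℤ
  e = updateAt (const ℤ.0ℤ) k (const ℤ.1ℤ)
  1≢0 : ℤ.1ℤ ≢ ℤ.0ℤ
  1≢0 ()
independent⊎relation (suc m) P P? v with Fin.any? (λ i → P? i ×-dec ¬? (v i Fin.zero ℤ.≟ ℤ.0ℤ))
... | yes (p , Pp , a≢0) =
  Sum.map independent relation (independent⊎relation m P′ (λ i → P? i ×-dec ¬? (i Fin.≟ p)) v′)
  where open Pivot P v p Pp a≢0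
... | no ¬∃pivot =
  Sum.map (independent-dropColumn {v = v}) (relation-dropColumn column₀≡0) (independent⊎relation m P P? (λ i j → v i (Fin.suc j)))
  where
  column₀≡0 : ∀ i → P i → v i Fin.zero ≡ ℤ.0ℤ
  column₀≡0 i Pi with v i Fin.zero ℤ.≟ ℤ.0ℤ
  ... | yes vi₀≡0 = vi₀≡0
  ... | no vi₀≢0 = ⊥-elim (¬∃pivot (i , Pi , vi₀≢0))

-- Degrees

rank : Deg → ℕ
rank nothing  = 0
rank (just d) = suc d

rank-mono : ∀ {x y} → x ≤D y → rank x ℕ.≤ rank y
rank-mono -∞≤      = ℕ.z≤n
rank-mono (fin≤ p) = ℕ.s≤s p

rank-reflects : ∀ {x y} → rank x ℕ.≤ rank y → x ≤D y
rank-reflects {nothing}            _            = -∞≤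
rank-reflects {just d} {just e}    (ℕ.s≤s d≤e)  = fin≤ d≤e

rank-injective : ∀ {x y} → rank x ≡ rank y → x ≡ y
rank-injective {nothing} {nothing} _    = refl
rank-injective {just d}  {just e}  refl = refl

rank-maxDeg : ∀ x y → rank (maxDeg x y) ≡ rank x ℕ.⊔ rank y
rank-maxDeg nothing  y        = refl
rank-maxDeg (just d) nothing  = refl
rank-maxDeg (just d) (just e) = refl

≤D-refl : ∀ {x} → x ≤D x
≤D-refl = rank-reflects ℕ.≤-refl

≤D-trans : ∀ {x y z} → x ≤D y → y ≤D z → x ≤D z
≤D-trans x≤y y≤z = rank-reflects (ℕ.≤-trans (rank-mono x≤y) (rank-mono y≤z))

≡⇒≤D : ∀ {x y} → x ≡ y → x ≤D y
≡⇒≤D refl = ≤D-refl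

rank-strict : ∀ {x y} → x ≤D y → x ≢ y → rank x ℕ.< rank y
rank-strict x≤y x≢y = ℕ.≤∧≢⇒< (rank-mono x≤y) (x≢y ∘ rank-injective)

≰D⇒≥D : ∀ {x y} → ¬ x ≤D y → y ≤D x
≰D⇒≥D x≰y = rank-reflects (ℕ.≰⇒≥ (x≰y ∘ rank-reflects))

rank-≰D : ∀ {x y} → ¬ x ≤D y → rank y ℕ.< rank x
rank-≰D x≰y = ℕ.≰⇒> (x≰y ∘ rank-reflects)

_≤D?_ : ∀ x y → Dec (x ≤D y)
x ≤D? y = map′ rank-reflects rank-mono (rank x ℕ.≤? rank y)

_≟D_ : (x y : Deg) → Dec (x ≡ y)
_≟D_ = Maybe.≡-dec ℕ._≟_

maxDeg-upperˡ : ∀ x y → x ≤D maxDeg x y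
maxDeg-upperˡ x y = rank-reflects (≡.subst (rank x ℕ.≤_) (sym (rank-maxDeg x y)) (ℕ.m≤m⊔n _ _))

maxDeg-upperʳ : ∀ x y → y ≤D maxDeg x y
maxDeg-upperʳ x y = rank-reflects (≡.subst (rank y ℕ.≤_) (sym (rank-maxDeg x y)) (ℕ.m≤n⊔m _ _))

maxDeg-sel : ∀ x y → maxDeg x y ≡ x ⊎ maxDeg x y ≡ y
maxDeg-sel x y = Sum.map (λ eq → rank-injective (trans (rank-maxDeg x y) eq))
                         (λ eq → rank-injective (trans (rank-maxDeg x y) eq)) (ℕ.⊔-sel (rank x) (rank y))

polyDeg-bound : ∀ p k → coeff p k ≢ ℤ.0ℤ → just k ≤D polyDeg p
polyDeg-bound []      k       pk≢0 = ⊥-elim (pk≢0 refl)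
polyDeg-bound (a ∷ p) zero    pk≢0 with polyDeg p
... | just d = fin≤ ℕ.z≤n
... | nothing with a ℤ.≟ ℤ.0ℤ
...   | yes a≡0 = ⊥-elim (pk≢0 a≡0)
...   | no _    = fin≤ ℕ.z≤n
polyDeg-bound (a ∷ p) (suc k) pk≢0 with polyDeg p | polyDeg-bound p k pk≢0
... | just d | fin≤ k≤d = fin≤ (ℕ.s≤s k≤d)

polyDeg-top : ∀ p {d} → polyDeg p ≡ just d → coeff p d ≢ ℤ.0ℤ
polyDeg-top []      ()
polyDeg-top (a ∷ p) eq with polyDeg p in eqp
polyDeg-top (a ∷ p) refl | just d = polyDeg-top p eqp
... | nothing with a ℤ.≟ ℤ.0ℤ
polyDeg-top (a ∷ p) refl | nothing | no a≢0 = a≢0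

deg-bound : ∀ {m} (f : PolyVec m) j k → coeff (f j) k ≢ ℤ.0ℤ → just k ≤D deg f
deg-bound f Fin.zero    k fjk≢0 = ≤D-trans (polyDeg-bound (f Fin.zero) k fjk≢0) (maxDeg-upperˡ _ _)
deg-bound f (Fin.suc j) k fjk≢0 = ≤D-trans (deg-bound (f ∘ Fin.suc) j k fjk≢0) (maxDeg-upperʳ (polyDeg (f Fin.zero)) _)

deg-top : ∀ {m} (f : PolyVec m) {d} → deg f ≡ just d → ∃ λ j → coeff (f j) d ≢ ℤ.0ℤ
deg-top {suc m} f eq with maxDeg-sel (polyDeg (f Fin.zero)) (deg (f ∘ Fin.suc))
... | inj₁ max≡f₀ = Fin.zero , polyDeg-top (f Fin.zero) (trans (sym max≡f₀) eq)
... | inj₂ max≡rest = let (j , fj≢0) = deg-top (f ∘ Fin.suc) (trans (sym max≡rest) eq) in Fin.suc j , fj≢0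

deg-least : ∀ {m} (f : PolyVec m) e → (∀ j k → coeff (f j) k ≢ ℤ.0ℤ → just k ≤D e) → deg f ≤D e
deg-least f e bound with deg f in eq
... | nothing = -∞≤
... | just d  = let (j , fjd≢0) = deg-top f eq in bound j d fjd≢0

rankSum : ∀ {n} → (Fin n → Deg) → ℕ
rankSum D = sumℕ (rank ∘ D)

rankSum-mono : ∀ {n} {D E : Fin n → Deg} → (∀ i → D i ≤D E i) → rankSum D ℕ.≤ rankSum E
rankSum-mono D≤E = sumℕ-mono-≤ (rank-mono ∘ D≤E)

rankSum-cong : ∀ {n} {D E : Fin n → Deg} → (∀ i → D i ≡ E i) → rankSum D ≡ rankSum E
rankSum-cong D≡E = Σℕ.Σ-cong (cong rank ∘ D≡E)

rankSum-permute : ∀ {n} (D : Fin n → Deg) (π : Permutation′ n) → rankSum (D ∘ (π ⟨$⟩ʳ_)) ≡ rankSum D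
rankSum-permute D π = Σℕ.Σ-permute (rank ∘ D) π

-- Elementary operations and spans

_+ₚ_ : Poly → Poly → Poly
[]      +ₚ q       = q
(a ∷ p) +ₚ []      = a ∷ p
(a ∷ p) +ₚ (b ∷ q) = (a ℤ.+ b) ∷ (p +ₚ q)

_·ₚ_ : ℤ → Poly → Poly
x ·ₚ p = List.map (x ℤ.*_) p

coeff-+ₚ : ∀ p q k → coeff (p +ₚ q) k ≡ coeff p k ℤ.+ coeff q k
coeff-+ₚ []      q       k       = sym (ℤ.+-identityˡ _)
coeff-+ₚ (a ∷ p) []      k       = sym (ℤ.+-identityʳ _)
coeff-+ₚ (a ∷ p) (b ∷ q) zero    = refl
coeff-+ₚ (a ∷ p) (b ∷ q) (suc k) = coeff-+ₚ p q k

coeff-·ₚ : ∀ x p k → coeff (x ·ₚ p) k ≡ x ℤ.* coeff p k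
coeff-·ₚ x []      k       = sym (ℤ.*-zeroʳ x)
coeff-·ₚ x (a ∷ p) zero    = refl
coeff-·ₚ x (a ∷ p) (suc k) = coeff-·ₚ x p k

_+[_]·_ : ∀ {m} → PolyVec m → ℤ → PolyVec m → PolyVec m
(f +[ q ]· g) j = f j +ₚ (q ·ₚ g j)

coeff-+· : ∀ {m} (f g : PolyVec m) q j k → coeff ((f +[ q ]· g) j) k ≡ coeff (f j) k ℤ.+ q ℤ.* coeff (g j) k
coeff-+· f g q j k = trans (coeff-+ₚ (f j) _ k) (cong (λ t → coeff (f j) k ℤ.+ t) (coeff-·ₚ q (g j) k))

deg-+· : ∀ {m} (f g : PolyVec m) q {e} → deg f ≤D e → deg g ≤D e → deg (f +[ q ]· g) ≤D e
deg-+· f g q {e} f≤e g≤e = deg-least (f +[ q ]· g) e bound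
  where
  bound : ∀ j k → coeff ((f +[ q ]· g) j) k ≢ ℤ.0ℤ → just k ≤D e
  bound j k h≢0 with coeff (f j) k ℤ.≟ ℤ.0ℤ | coeff (g j) k ℤ.≟ ℤ.0ℤ
  ... | no fjk≢0 | _        = ≤D-trans (deg-bound f j k fjk≢0) f≤e
  ... | yes _    | no gjk≢0 = ≤D-trans (deg-bound g j k gjk≢0) g≤e
  ... | yes fjk≡0 | yes gjk≡0 = ⊥-elim (h≢0 (begin
    coeff ((f +[ q ]· g) j) k            ≡⟨ coeff-+· f g q j k ⟩
    coeff (f j) k ℤ.+ q ℤ.* coeff (g j) k ≡⟨ cong₂ (λ s t → s ℤ.+ q ℤ.* t) fjk≡0 gjk≡0 ⟩
    ℤ.0ℤ ℤ.+ q ℤ.* ℤ.0ℤ                   ≡⟨ trans (ℤ.+-identityˡ _) (ℤ.*-zeroʳ q) ⟩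
    ℤ.0ℤ                                  ∎))
    where open ≡.≡-Reasoning

addMultiple : ∀ {n m} → (Fin n → PolyVec m) → Fin n → Fin n → ℤ → Fin n → PolyVec m
addMultiple g a b q = updateAt g a (_+[ q ]· g b)

coeff-addMultiple : ∀ {n m} (g : Fin n → PolyVec m) a b q j k i →
  coeff (addMultiple g a b q i j) k ≡ updateAt (λ i → coeff (g i j) k) a (ℤ._+ q ℤ.* coeff (g b j) k) i
coeff-addMultiple g a b q j k i with i Fin.≟ a
... | yes refl = trans (cong (λ h → coeff (h j) k) (updateAt-updates i g))
                       (trans (coeff-+· (g i) (g b) q j k) (sym (updateAt-updates i (λ i → coeff (g i j) k))))
... | no i≢a = trans (cong (λ h → coeff (h j) k) (updateAt-minimal i a g i≢a))
                     (sym (updateAt-minimal i a (λ i → coeff (g i j) k) i≢a))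

module ⇔ = IsEquivalence (⇔-isEquivalence {0ℓ})

SameSpan-refl : ∀ {m n} (g : Fin n → PolyVec m) → SameSpan g g
SameSpan-refl g v = ⇔.refl

SameSpan-trans : ∀ {m n} (f g h : Fin n → PolyVec m) → SameSpan f g → SameSpan g h → SameSpan f h
SameSpan-trans f g h f~g g~h v = ⇔.trans (f~g v) (g~h v)

SameSpan-addMultiple : ∀ {m n} (g : Fin n → PolyVec m) {a b} q → a ≢ b → SameSpan (addMultiple g a b q) g
SameSpan-addMultiple g {a} {b} q a≢b v = mk⇔ to from
  where
  open ≡.≡-Reasoning
  X : Fin _ → ℕ → Fin _ → ℤ
  X j k i = coeff (g i j) k
  Σ-addMultiple : ∀ c j k → sumℤ (λ i → c i ℤ.* coeff (addMultiple g a b q i j) k)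
                            ≡ sumℤ (λ i → c i ℤ.* updateAt (X j k) a (ℤ._+ q ℤ.* X j k b) i)
  Σ-addMultiple c j k = Σℤ.Σ-cong (λ i → cong (c i ℤ.*_) (coeff-addMultiple g a b q j k i))
  to : InSpan v (addMultiple g a b q) → InSpan v g
  to (c , v≡) = updateAt c b (ℤ._+ c a ℤ.* q) , λ j k → begin
    coeff (v j) k                                                   ≡⟨ trans (v≡ j k) (Σ-addMultiple c j k) ⟩
    sumℤ (λ i → c i ℤ.* updateAt (X j k) a (ℤ._+ q ℤ.* X j k b) i) ≡⟨ Σℤ.Σ-addAtʳ c (X j k) a _ ⟩
    sumℤ (λ i → c i ℤ.* X j k i) ℤ.+ c a ℤ.* (q ℤ.* X j k b)        ≡⟨ cong (λ t → sumℤ (λ i → c i ℤ.* X j k i) ℤ.+ t) (ℤ.*-assoc (c a) q _) ⟨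
    sumℤ (λ i → c i ℤ.* X j k i) ℤ.+ c a ℤ.* q ℤ.* X j k b          ≡⟨ Σℤ.Σ-addAtˡ c (X j k) b _ ⟨
    sumℤ (λ i → updateAt c b (ℤ._+ c a ℤ.* q) i ℤ.* X j k i)        ∎
  from : InSpan v g → InSpan v (addMultiple g a b q)
  from (c , v≡) = updateAt c b (ℤ._+ ℤ.- (c a ℤ.* q)) , λ j k → begin
    coeff (v j) k                                 ≡⟨ v≡ j k ⟩
    sumℤ (λ i → c i ℤ.* X j k i)                  ≡⟨ Σℤ-transvection c (X j k) q a≢b ⟨
    sumℤ (λ i → updateAt c b (ℤ._+ ℤ.- (c a ℤ.* q)) i ℤ.* updateAt (X j k) a (ℤ._+ q ℤ.* X j k b) i)
                                                  ≡⟨ Σ-addMultiple (updateAt c b (ℤ._+ ℤ.- (c a ℤ.* q))) j k ⟨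
    sumℤ (λ i → updateAt c b (ℤ._+ ℤ.- (c a ℤ.* q)) i ℤ.* coeff (addMultiple g a b q i j) k) ∎

SameSpan-permute : ∀ {m n} (g : Fin n → PolyVec m) (π : Permutation′ n) → SameSpan (g ∘ (π ⟨$⟩ʳ_)) g
SameSpan-permute g π v = mk⇔ to from
  where
  open ≡.≡-Reasoning
  to : InSpan v (g ∘ (π ⟨$⟩ʳ_)) → InSpan v g
  to (c , v≡) = c ∘ (π ⟨$⟩ˡ_) , λ j k → begin
    coeff (v j) k                                                     ≡⟨ v≡ j k ⟩
    sumℤ (λ i → c i ℤ.* coeff (g (π ⟨$⟩ʳ i) j) k)                     ≡⟨ Σℤ.Σ-cong (λ i → cong (λ i′ → c i′ ℤ.* coeff (g (π ⟨$⟩ʳ i) j) k) (Perm.inverseˡ π)) ⟨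
    sumℤ (λ i → c (π ⟨$⟩ˡ (π ⟨$⟩ʳ i)) ℤ.* coeff (g (π ⟨$⟩ʳ i) j) k)  ≡⟨ Σℤ.Σ-permute (λ i → c (π ⟨$⟩ˡ i) ℤ.* coeff (g i j) k) π ⟩
    sumℤ (λ i → c (π ⟨$⟩ˡ i) ℤ.* coeff (g i j) k)                     ∎
  from : InSpan v g → InSpan v (g ∘ (π ⟨$⟩ʳ_))
  from (c , v≡) = c ∘ (π ⟨$⟩ʳ_) , λ j k → trans (v≡ j k) (sym (Σℤ.Σ-permute (λ i → c i ℤ.* coeff (g i j) k) π))

PilotIndep-permute : ∀ {m n} (g : Fin n → PolyVec m) (π : Permutation′ n) {d} → PilotIndep g d → PilotIndep (g ∘ (π ⟨$⟩ʳ_)) d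
PilotIndep-permute g π {d} indep c c-supported c-vanishes i = begin
  c i                         ≡⟨ cong c (Perm.inverseˡ π) ⟨
  c (π ⟨$⟩ˡ (π ⟨$⟩ʳ i))       ≡⟨ indep (c ∘ (π ⟨$⟩ˡ_)) c′-supported c′-vanishes (π ⟨$⟩ʳ i) ⟩
  ℚ.0ℚ                        ∎
  where
  open ≡.≡-Reasoning
  c′-supported : ∀ i → ¬ deg (g i) ≡ just d → c (π ⟨$⟩ˡ i) ≡ ℚ.0ℚ
  c′-supported i gi≢d = c-supported (π ⟨$⟩ˡ i) (gi≢d ∘ trans (cong (deg ∘ g) (sym (Perm.inverseʳ π))))
  c′-vanishes : ∀ j → sumℚ (λ i → c (π ⟨$⟩ˡ i) ℚ.* toℚ (pilot (g i) d j)) ≡ ℚ.0ℚ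
  c′-vanishes j = begin
    sumℚ (λ i → c (π ⟨$⟩ˡ i) ℚ.* toℚ (pilot (g i) d j))                              ≡⟨ Σℚ.Σ-permute (λ i → c (π ⟨$⟩ˡ i) ℚ.* toℚ (pilot (g i) d j)) π ⟨
    sumℚ (λ i → c (π ⟨$⟩ˡ (π ⟨$⟩ʳ i)) ℚ.* toℚ (pilot (g (π ⟨$⟩ʳ i)) d j))            ≡⟨ Σℚ.Σ-cong (λ i → cong (λ i′ → c i′ ℚ.* toℚ (pilot (g (π ⟨$⟩ʳ i)) d j)) (Perm.inverseˡ π)) ⟩
    sumℚ (λ i → c i ℚ.* toℚ (pilot (g (π ⟨$⟩ʳ i)) d j))                              ≡⟨ c-vanishes j ⟩
    ℚ.0ℚ                                                                              ∎

record _≼_ {n m} (h g : Fin n → PolyVec m) : Set where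
  constructor mk≼
  field
    sameSpan : SameSpan h g
    deg≤     : ∀ i → deg (h i) ≤D deg (g i)

≼-refl : ∀ {n m} (g : Fin n → PolyVec m) → g ≼ g
≼-refl g = mk≼ (SameSpan-refl g) (λ _ → ≤D-refl)

≼-trans : ∀ {n m} {h g f : Fin n → PolyVec m} → h ≼ g → g ≼ f → h ≼ f
≼-trans {h = h} {g} {f} (mk≼ h~g h≤g) (mk≼ g~f g≤f) =
  mk≼ (SameSpan-trans h g f h~g g~f) (λ i → ≤D-trans (h≤g i) (g≤f i))

-- Lowering a degree along a pilot relation

PilotRelation : ∀ {n m} → (Fin n → PolyVec m) → ℕ → Set
PilotRelation g d = Relation (λ i → deg (g i) ≡ just d) (λ i → pilot (g i) d)

size : ∀ {n m} {P : Fin n → Set} {v : Fin n → Fin m → ℤ} → Relation P v → ℕ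
size r = sumℕ (λ i → ℤ.∣ coef i ∣)
  where open Relation r

module _ {n m} {g : Fin n → PolyVec m} {d} (r : PilotRelation g d) where
  open Relation r

  coef≢0⇒deg≡ : ∀ {i} → coef i ≢ ℤ.0ℤ → deg (g i) ≡ just d
  coef≢0⇒deg≡ {i} ci≢0 = decidable-stable (deg (g i) ≟D just d) (ci≢0 ∘ supported i)

  -- A single nonzero multiple of a nonzero pilot vector cannot vanish.
  second-term : ∃ λ j → j ≢ witness × coef j ≢ ℤ.0ℤ
  second-term with Fin.any? (λ j → ¬? (j Fin.≟ witness) ×-dec ¬? (coef j ℤ.≟ ℤ.0ℤ))
  ... | yes (j , j≢w , cj≢0) = j , j≢w , cj≢0
  ... | no ∄j = ⊥-elim (witness-term≢0 (begin
    coef witness ℤ.* pilot (g witness) d l ≡⟨ Σℤ.Σ-single witness others-vanish ⟨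
    sumℤ (λ i → coef i ℤ.* pilot (g i) d l) ≡⟨ vanishes l ⟩
    ℤ.0ℤ                                    ∎))
    where
    open ≡.≡-Reasoning
    top = deg-top (g witness) (coef≢0⇒deg≡ witness≢0)
    l = proj₁ top
    witness-term≢0 : coef witness ℤ.* pilot (g witness) d l ≢ ℤ.0ℤ
    witness-term≢0 eq = Sum.[ witness≢0 , proj₂ top ] (ℤ.i*j≡0⇒i≡0∨j≡0 (coef witness) eq)
    others-vanish : ∀ i → i ≢ witness → coef i ℤ.* pilot (g i) d l ≡ ℤ.0ℤ
    others-vanish i i≢w with coef i ℤ.≟ ℤ.0ℤ
    ... | yes ci≡0 = trans (cong (ℤ._* pilot (g i) d l) ci≡0) (ℤ.*-zeroˡ (pilot (g i) d l))
    ... | no ci≢0  = ⊥-elim (∄j (i , i≢w , ci≢0))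

  two-terms : ∃₂ λ a b → a ≢ b × coef a ≢ ℤ.0ℤ × coef b ≢ ℤ.0ℤ × ℤ.∣ coef a ∣ ℕ.≤ ℤ.∣ coef b ∣
  two-terms with second-term
  ... | (j , j≢w , cj≢0) with ℤ.∣ coef j ∣ ℕ.≤? ℤ.∣ coef witness ∣
  ...   | yes cj≤cw = j , witness , j≢w , cj≢0 , witness≢0 , cj≤cw
  ...   | no cj≰cw  = witness , j , j≢w ∘ sym , witness≢0 , cj≢0 , ℕ.≰⇒≥ cj≰cw

module EuclidStep {n m} {g : Fin n → PolyVec m} {d} (r : PilotRelation g d) {a b : Fin n} (a≢b : a ≢ b)
                  (ca≢0 : Relation.coef r a ≢ ℤ.0ℤ) (cb≢0 : Relation.coef r b ≢ ℤ.0ℤ)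
                  (|ca|≤|cb| : ℤ.∣ Relation.coef r a ∣ ℕ.≤ ℤ.∣ Relation.coef r b ∣) where
  open Relation r renaming (coef to c)
  open ≡.≡-Reasoning
  instance
    ca-nonZero : ℤ.NonZero (c a)
    ca-nonZero = ℤ.≢-nonZero ca≢0

  q : ℤ
  q = c b ℤ./ c a

  g₁ : Fin n → PolyVec m
  g₁ = addMultiple g a b q

  g₁≡g : ∀ {i} → i ≢ a → g₁ i ≡ g i
  g₁≡g {i} i≢a = updateAt-minimal i a g i≢a

  g₁a≤d : deg (g₁ a) ≤D just d
  g₁a≤d = ≡.subst (λ h → deg h ≤D just d) (sym (updateAt-updates a g))
            (deg-+· (g a) (g b) q (≡⇒≤D (coef≢0⇒deg≡ r ca≢0)) (≡⇒≤D (coef≢0⇒deg≡ r cb≢0)))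

  g₁≼g : g₁ ≼ g
  g₁≼g = mk≼ (SameSpan-addMultiple g q a≢b) deg≤
    where
    deg≤ : ∀ i → deg (g₁ i) ≤D deg (g i)
    deg≤ i with i Fin.≟ a
    ... | yes refl = ≡.subst (deg (g₁ i) ≤D_) (sym (coef≢0⇒deg≡ r ca≢0)) g₁a≤d
    ... | no i≢a   = ≡⇒≤D (cong deg (g₁≡g i≢a))

  rankSum-drop : deg (g₁ a) ≢ just d → rankSum (deg ∘ g₁) ℕ.< rankSum (deg ∘ g)
  rankSum-drop g₁a≢d = sumℕ-mono-< a (rank-mono ∘ _≼_.deg≤ g₁≼g)
    (≡.subst (λ e → rank (deg (g₁ a)) ℕ.< rank e) (sym (coef≢0⇒deg≡ r ca≢0)) (rank-strict g₁a≤d g₁a≢d))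

  -- The relation c for g becomes one for g₁ in which c b is replaced by its remainder modulo c a.
  c₁ : Fin n → ℤ
  c₁ = updateAt c b (ℤ._+ ℤ.- (c a ℤ.* q))

  c₁b≡remainder : c₁ b ≡ ℤ.+ (c b ℤ.% c a)
  c₁b≡remainder = begin
    c₁ b                                   ≡⟨ updateAt-updates b c ⟩
    c b ℤ.+ ℤ.- (c a ℤ.* q)                 ≡⟨ cong (λ t → t ℤ.+ ℤ.- (c a ℤ.* q)) (ℤD.a≡a%n+[a/n]*n (c b) (c a)) ⟩
    ℤ.+ (c b ℤ.% c a) ℤ.+ q ℤ.* c a ℤ.+ ℤ.- (c a ℤ.* q) ≡⟨ cancel _ q (c a) ⟩
    ℤ.+ (c b ℤ.% c a)                       ∎
    where
    cancel : ∀ s q x → s ℤ.+ q ℤ.* x ℤ.+ ℤ.- (x ℤ.* q) ≡ s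
    cancel = solve-∀

  relation₁ : deg (g₁ a) ≡ just d → PilotRelation g₁ d
  relation₁ g₁a≡d = record
    { coef      = c₁
    ; supported = c₁-supported
    ; witness   = a
    ; witness≢0 = ca≢0 ∘ trans (sym (updateAt-minimal a b c a≢b))
    ; vanishes  = c₁-vanishes
    }
    where
    c₁-supported : ∀ i → deg (g₁ i) ≢ just d → c₁ i ≡ ℤ.0ℤ
    c₁-supported i g₁i≢d with i Fin.≟ a | i Fin.≟ b
    ... | yes refl | _        = ⊥-elim (g₁i≢d g₁a≡d)
    ... | no i≢a   | yes refl = ⊥-elim (g₁i≢d (trans (cong deg (g₁≡g i≢a)) (coef≢0⇒deg≡ r cb≢0)))
    ... | no i≢a   | no i≢b   = trans (updateAt-minimal i b c i≢b) (supported i (g₁i≢d ∘ trans (cong deg (g₁≡g i≢a))))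
    c₁-vanishes : ∀ j → sumℤ (λ i → c₁ i ℤ.* pilot (g₁ i) d j) ≡ ℤ.0ℤ
    c₁-vanishes j = begin
      sumℤ (λ i → c₁ i ℤ.* pilot (g₁ i) d j)
        ≡⟨ Σℤ.Σ-cong (λ i → cong (c₁ i ℤ.*_) (coeff-addMultiple g a b q j d i)) ⟩
      sumℤ (λ i → c₁ i ℤ.* updateAt (λ i → pilot (g i) d j) a (ℤ._+ q ℤ.* pilot (g b) d j) i)
        ≡⟨ Σℤ-transvection c (λ i → pilot (g i) d j) q a≢b ⟩
      sumℤ (λ i → c i ℤ.* pilot (g i) d j)
        ≡⟨ vanishes j ⟩
      ℤ.0ℤ ∎

  size-drop : (g₁a≡d : deg (g₁ a) ≡ just d) → size (relation₁ g₁a≡d) ℕ.< size r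
  size-drop _ = sumℕ-mono-< b |c₁|≤|c| |c₁b|<|cb|
    where
    |c₁b|<|cb| : ℤ.∣ c₁ b ∣ ℕ.< ℤ.∣ c b ∣
    |c₁b|<|cb| = ≡.subst (ℕ._< ℤ.∣ c b ∣) (sym (cong ℤ.∣_∣ c₁b≡remainder)) (ℕ.<-≤-trans (ℤD.n%d<d (c b) (c a)) |ca|≤|cb|)
    |c₁|≤|c| : ∀ i → ℤ.∣ c₁ i ∣ ℕ.≤ ℤ.∣ c i ∣
    |c₁|≤|c| i with i Fin.≟ b
    ... | yes refl = ℕ.<⇒≤ |c₁b|<|cb|
    ... | no i≢b   = ℕ.≤-reflexive (cong ℤ.∣_∣ (updateAt-minimal i b c i≢b))

lowerDegree : ∀ {n m} {g : Fin n → PolyVec m} {d} (r : PilotRelation g d) → Acc ℕ._<_ (size r) →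
              Σ[ g′ ∈ (Fin n → PolyVec m) ] g′ ≼ g × rankSum (deg ∘ g′) ℕ.< rankSum (deg ∘ g)
lowerDegree {n} {m} {g} {d} r (acc rec) with two-terms r
... | (a , b , a≢b , ca≢0 , cb≢0 , |ca|≤|cb|) = step (deg (g₁ a) ≟D just d)
  where
  open EuclidStep r a≢b ca≢0 cb≢0 |ca|≤|cb|
  step : Dec (deg (g₁ a) ≡ just d) → Σ[ g′ ∈ (Fin n → PolyVec m) ] g′ ≼ g × rankSum (deg ∘ g′) ℕ.< rankSum (deg ∘ g)
  step (no g₁a≢d)  = g₁ , g₁≼g , rankSum-drop g₁a≢d
  step (yes g₁a≡d) =
    let (g′ , g′≼g₁ , g′<g₁) = lowerDegree (relation₁ g₁a≡d) (rec (size-drop g₁a≡d))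
    in g′ , ≼-trans g′≼g₁ g₁≼g , ℕ.<-≤-trans g′<g₁ (rankSum-mono (_≼_.deg≤ g₁≼g))

-- Reaching pilot independence

pilotIndep-vacuous : ∀ {n m} (g : Fin n → PolyVec m) {d} → (∀ i → deg (g i) ≢ just d) → PilotIndep g d
pilotIndep-vacuous g ∄i c c-supported _ i = c-supported i (∄i i)

forall⊎ : ∀ {n} {A : Fin n → Set} {B : Set} → (∀ i → A i ⊎ B) → (∀ i → A i) ⊎ B
forall⊎ {zero}  h = inj₁ λ ()
forall⊎ {suc n} h with h Fin.zero | forall⊎ (h ∘ Fin.suc)
... | inj₂ b | _       = inj₂ b
... | inj₁ _ | inj₂ b  = inj₂ b
... | inj₁ a | inj₁ as = inj₁ λ { Fin.zero → a ; (Fin.suc i) → as i }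

pilotIndep⊎relation : ∀ {n m} (g : Fin n → PolyVec m) d → PilotIndep g d ⊎ PilotRelation g d
pilotIndep⊎relation {m = m} g d = independent⊎relation m _ (λ i → deg (g i) ≟D just d) (λ i → pilot (g i) d)

allPilotIndep⊎relation : ∀ {n m} (g : Fin n → PolyVec m) → (∀ d → PilotIndep g d) ⊎ ∃ (PilotRelation g)
allPilotIndep⊎relation g = Sum.map₁ indepAtEveryDegree (forall⊎ indepAtDegreeOf)
  where
  indepAtDegreeOf : ∀ i → (∀ d → deg (g i) ≡ just d → PilotIndep g d) ⊎ ∃ (PilotRelation g)
  indepAtDegreeOf i with deg (g i)
  ... | nothing = inj₁ λ _ ()
  ... | just d  = Sum.map (λ indep → λ { _ refl → indep }) (d ,_) (pilotIndep⊎relation g d)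
  indepAtEveryDegree : (∀ i d → deg (g i) ≡ just d → PilotIndep g d) → ∀ d → PilotIndep g d
  indepAtEveryDegree indep d with Fin.any? (λ i → deg (g i) ≟D just d)
  ... | yes (i , gi≡d) = indep i d gi≡d
  ... | no ∄i          = pilotIndep-vacuous g (λ i gi≡d → ∄i (i , gi≡d))

reduce : ∀ {n m} (g : Fin n → PolyVec m) → Acc ℕ._<_ (rankSum (deg ∘ g)) →
         Σ[ h ∈ (Fin n → PolyVec m) ] h ≼ g × (∀ d → PilotIndep h d)
reduce g (acc rec) with allPilotIndep⊎relation g
... | inj₁ indep   = g , ≼-refl g , indep
... | inj₂ (d , r) =
  let (g₁ , g₁≼g , g₁<g)   = lowerDegree r (ℕ.<-wellFounded (size r))
      (h , h≼g₁ , h-indep) = reduce g₁ (rec g₁<g)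
  in h , ≼-trans h≼g₁ g₁≼g , h-indep

-- Sorting by degree

transpose-matchˡ : ∀ {n} (i j : Fin n) → Perm.transpose i j ⟨$⟩ʳ i ≡ j
transpose-matchˡ i j rewrite dec-true (i Fin.≟ i) refl = refl

transpose-matchʳ : ∀ {n} (i j : Fin n) → Perm.transpose i j ⟨$⟩ʳ j ≡ i
transpose-matchʳ i j with j Fin.≟ i
... | yes refl = refl
... | no _ rewrite dec-true (j Fin.≟ j) refl = refl

transpose-other : ∀ {n} {i j k : Fin n} → k ≢ i → k ≢ j → Perm.transpose i j ⟨$⟩ʳ k ≡ k
transpose-other {i = i} {j} {k} k≢i k≢j rewrite dec-false (k Fin.≟ i) k≢i | dec-false (k Fin.≟ j) k≢j = refl

Sorted : ∀ {n} → (Fin n → Deg) → Set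
Sorted {n} D = ∀ (i j : Fin n) → i Fin.≤ j → D i ≤D D j

adjacent⇒sorted : ∀ {n} (D : Fin (suc n) → Deg) → (∀ k → D (Fin.inject₁ k) ≤D D (Fin.suc k)) → Sorted D
adjacent⇒sorted         D adj Fin.zero    Fin.zero    _            = ≤D-refl
adjacent⇒sorted {suc n} D adj Fin.zero    (Fin.suc j) _            =
  ≤D-trans (adj Fin.zero) (adjacent⇒sorted (D ∘ Fin.suc) (adj ∘ Fin.suc) Fin.zero j ℕ.z≤n)
adjacent⇒sorted {suc n} D adj (Fin.suc i) (Fin.suc j) (ℕ.s≤s i≤j) =
  adjacent⇒sorted (D ∘ Fin.suc) (adj ∘ Fin.suc) i j i≤j

-- Entries further to the front count more, so moving a larger degree backwards decreases it.
displacement : ∀ {n} → (Fin n → Deg) → ℕ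
displacement {n} D = sumℕ (λ i → (n ℕ.∸ Fin.toℕ i) ℕ.* rank (D i))

rearrangement-< : ∀ K {x y} → x ℕ.< y → suc K ℕ.* x ℕ.+ K ℕ.* y ℕ.< suc K ℕ.* y ℕ.+ K ℕ.* x
rearrangement-< K {x} {y} x<y = ≡.subst₂ ℕ._<_ (regroupˡ K x y) (regroupʳ K x y) (ℕ.+-monoˡ-< (K ℕ.* (x ℕ.+ y)) x<y)
  where
  regroupˡ : ∀ K x y → x ℕ.+ K ℕ.* (x ℕ.+ y) ≡ suc K ℕ.* x ℕ.+ K ℕ.* y
  regroupˡ = ℕ-solve-∀
  regroupʳ : ∀ K x y → y ℕ.+ K ℕ.* (x ℕ.+ y) ≡ suc K ℕ.* y ℕ.+ K ℕ.* x
  regroupʳ = ℕ-solve-∀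

module AdjacentSwap {n} (D : Fin (suc n) → Deg) (k : Fin n) where
  a b : Fin (suc n)
  a = Fin.inject₁ k
  b = Fin.suc k

  τ : Permutation′ (suc n)
  τ = Perm.transpose a b

  a≢b : a ≢ b
  a≢b a≡b = ℕ.1+n≢n (sym (trans (sym (Fin.toℕ-inject₁ k)) (cong Fin.toℕ a≡b)))

  a≤b : a Fin.≤ b
  a≤b = ℕ.≤-trans (ℕ.≤-reflexive (Fin.toℕ-inject₁ k)) (ℕ.n≤1+n _)

  bounded : ∀ (E : Fin (suc n) → Deg) → Sorted E → (∀ i → D i ≤D E i) → D b ≤D D a →
            ∀ i → D (τ ⟨$⟩ʳ i) ≤D E i
  bounded E E-sorted D≤E Db≤Da i = bound (i Fin.≟ a) (i Fin.≟ b)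
    where
    bound : Dec (i ≡ a) → Dec (i ≡ b) → D (τ ⟨$⟩ʳ i) ≤D E i
    bound (yes refl) _        rewrite transpose-matchˡ a b = ≤D-trans Db≤Da (D≤E a)
    bound (no _)     (yes refl) rewrite transpose-matchʳ a b = ≤D-trans (D≤E a) (E-sorted a b a≤b)
    bound (no i≢a)   (no i≢b)   rewrite transpose-other i≢a i≢b = D≤E i

  displacement-drop : rank (D b) ℕ.< rank (D a) → displacement (D ∘ (τ ⟨$⟩ʳ_)) ℕ.< displacement D
  displacement-drop rb<ra = ℕ.≰⇒> λ Δ≤Δτ → ℕ.<-irrefl (sym swap-balance) (ℕ.+-mono-≤-< Δ≤Δτ terms<)
    where
    N : Fin (suc n) → ℕ
    N i = suc n ℕ.∸ Fin.toℕ i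
    F G : Fin (suc n) → ℕ
    F i = N i ℕ.* rank (D (τ ⟨$⟩ʳ i))
    G i = N i ℕ.* rank (D i)
    swap-balance : sumℕ F ℕ.+ (G a ℕ.+ G b) ≡ sumℕ G ℕ.+ (F a ℕ.+ F b)
    swap-balance = Σℕ.Σ-two F G a b a≢b (λ i i≢a i≢b → cong (λ t → N i ℕ.* rank (D t)) (transpose-other i≢a i≢b))
    K = n ℕ.∸ Fin.toℕ k
    Na≡1+K : N a ≡ suc K
    Na≡1+K = trans (cong (suc n ℕ.∸_) (Fin.toℕ-inject₁ k)) (ℕ.+-∸-assoc 1 (ℕ.<⇒≤ (Fin.toℕ<n k)))
    terms< : F a ℕ.+ F b ℕ.< G a ℕ.+ G b
    terms< rewrite transpose-matchˡ a b | transpose-matchʳ a b | Na≡1+K = rearrangement-< K rb<ra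

sortByDeg : ∀ {n} (D E : Fin n → Deg) → Sorted E → (∀ i → D i ≤D E i) → Acc ℕ._<_ (displacement D) →
            Σ[ π ∈ Permutation′ n ] Sorted (D ∘ (π ⟨$⟩ʳ_)) × (∀ i → D (π ⟨$⟩ʳ i) ≤D E i)
sortByDeg {zero}  D E _        D≤E _         = Perm.id , (λ ()) , D≤E
sortByDeg {suc n} D E E-sorted D≤E (acc rec) with Fin.any? (λ k → ¬? (D (Fin.inject₁ k) ≤D? D (Fin.suc k)))
... | no ∄inversion = Perm.id , adjacent⇒sorted D adjacent , D≤E
  where
  adjacent : ∀ k → D (Fin.inject₁ k) ≤D D (Fin.suc k)
  adjacent k = decidable-stable (D (Fin.inject₁ k) ≤D? D (Fin.suc k)) (λ inversion → ∄inversion (k , inversion))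
... | yes (k , inversion) =
  let (π , sorted , bound) = sortByDeg (D ∘ (τ ⟨$⟩ʳ_)) E E-sorted (bounded E E-sorted D≤E (≰D⇒≥D inversion))
                                       (rec (displacement-drop (rank-≰D inversion)))
  in π Perm.∘ₚ τ , sorted , bound
  where open AdjacentSwap D k

proposition3p16 : ∀ {m n : ℕ} (f : Fin n → PolyVec m) → DegSorted f →
    Σ (Fin n → PolyVec m) λ g →
      DegSorted g
      × SameSpan g f
      × (∀ i → deg (g i) ≤D deg (f i))
      × (∀ (d : ℕ) → PilotIndep g d)
      × ((∀ i → deg (g i) ≡ deg (f i)) ⇔ (∀ (d : ℕ) → PilotIndep f d))
proposition3p16 f f-sorted with allPilotIndep⊎relation f
... | inj₁ f-indep = f , f-sorted , SameSpan-refl f , (λ _ → ≤D-refl) , f-indep , mk⇔ (λ _ → f-indep) (λ _ _ → refl)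
... | inj₂ (d , r) =
  let (g₁ , g₁≼f , g₁<f)    = lowerDegree r (ℕ.<-wellFounded (size r))
      (h , h≼g₁ , h-indep)  = reduce g₁ (ℕ.<-wellFounded (rankSum (deg ∘ g₁)))
      mk≼ h~f h≤f           = ≼-trans h≼g₁ g₁≼f
      (π , sorted , hπ≤f)   = sortByDeg (deg ∘ h) (deg ∘ f) f-sorted h≤f (ℕ.<-wellFounded _)
      hπ<f                  = ≡.subst (ℕ._< rankSum (deg ∘ f)) (sym (rankSum-permute (deg ∘ h) π))
                                (ℕ.≤-<-trans (rankSum-mono (_≼_.deg≤ h≼g₁)) g₁<f)
  in h ∘ (π ⟨$⟩ʳ_) , sorted , SameSpan-trans (h ∘ (π ⟨$⟩ʳ_)) h f (SameSpan-permute h π) h~f , hπ≤f ,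
     (λ d → PilotIndep-permute h π (h-indep d)) ,
     mk⇔ (λ degs≡ → ⊥-elim (ℕ.<-irrefl (rankSum-cong degs≡) hπ<f))
         (λ f-indep → ⊥-elim (relation⇒¬independent r (f-indep d)))
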